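{- Let $n \geq 3$ and $1 \leq \ell \leq n-2$ be integers. Consider the game in which, starting from the empty graph on $n$ vertices, two players alternately claim an arbitrary edge of $K_n$ not yet claimed (with no other restriction), and let $G$ denote the graph of all edges claimed so far by both players. Then either player, regardless of who moves first and of the other player's moves, can ensure that immediately after one of his own moves the graph $G$ contains a path $P$ such that: (a) the length of $P$ is $\ell$ or $\ell+1$; (b) every vertex of $G$ not on $P$ has degree $0$ in $G$; (c) at least one endpoint of $P$ has degree $1$ in $G$. -}

module Defs where

open import Data.Nat using (ℕ; zero; suc)
open import Data.Fin using (Fin; zero; suc; _<_; inject₁; fromℕ) renaming (_≟_ to _≟ᶠ_)
open import Data.List using (List; []; _∷_; length; filter; allFin)
open import Data.List.Relation.Unary.Any using (Any; any?)
open import Data.Product using (Σ; ∃; _×_; _,_; proj₁; proj₂)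
open import Data.Sum using (_⊎_)
open import Relation.Nullary using (¬_; Dec)
open import Relation.Nullary.Decidable using (_×-dec_; _⊎-dec_)
open import Relation.Binary.PropositionalEquality using (_≡_; _≢_)
open import Function.Definitions using (Injective)

-- A graph on vertex set Fin n, given by the list of claimed edges
-- (an edge is an unordered pair, stored as a pair of vertices).
Graph : ℕ → Set
Graph n = List (Fin n × Fin n)

Adj : ∀ {n} → Graph n → Fin n → Fin n → Set
Adj G u v = Any (λ e → (proj₁ e ≡ u × proj₂ e ≡ v) ⊎ (proj₁ e ≡ v × proj₂ e ≡ u)) G

Adj? : ∀ {n} (G : Graph n) (u v : Fin n) → Dec (Adj G u v)
Adj? G u v = any? (λ e → ((proj₁ e ≟ᶠ u) ×-dec (proj₂ e ≟ᶠ v)) ⊎-dec ((proj₁ e ≟ᶠ v) ×-dec (proj₂ e ≟ᶠ u))) G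

deg : ∀ {n} → Graph n → Fin n → ℕ
deg {n} G v = length (filter (Adj? G v) (allFin n))

Legal : ∀ {n} → Graph n → Fin n → Fin n → Set
Legal G i j = (i < j) × ¬ Adj G i j

IsPath : ∀ {n} → Graph n → (k : ℕ) → (Fin (suc k) → Fin n) → Set
IsPath G k p = Injective _≡_ _≡_ p × (∀ (i : Fin k) → Adj G (p (inject₁ i)) (p (suc i)))

Goal : ∀ {n} → ℕ → Graph n → Set
Goal {n} ℓ G =
  Σ ℕ λ k → (k ≡ ℓ ⊎ k ≡ suc ℓ) ×
  Σ (Fin (suc k) → Fin n) λ p →
    IsPath G k p ×
    (∀ (w : Fin n) → (∀ (i : Fin (suc k)) → p i ≢ w) → deg G w ≡ 0) ×
    (deg G (p zero) ≡ 1 ⊎ deg G (p (fromℕ k)) ≡ 1)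

-- Force ℓ G : the player to move in position G (claimed edges G) can ensure,
-- whatever the opponent does, that immediately after one of his own moves
-- the Goal holds.  Either he has a move after which Goal holds, or a move
-- after which the game is not over (the opponent has a legal move) and
-- after every legal reply of the opponent he can again force the Goal.
-- (The game is finite, so this inductive predicate is exactly the
-- existence of a winning strategy.)
data Force {n : ℕ} (ℓ : ℕ) : Graph n → Set where
  win  : ∀ {G} i j → Legal G i j → Goal ℓ ((i , j) ∷ G) → Force ℓ G
  play : ∀ {G} i j → Legal G i j →
         (Σ (Fin n) λ a → Σ (Fin n) λ b → Legal ((i , j) ∷ G) a b) →
         (∀ a b → Legal ((i , j) ∷ G) a b → Force ℓ ((a , b) ∷ (i , j) ∷ G)) →
         Force ℓ G

-- Either player maintains, after each of his moves, the invariant: the graph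
-- contains a path P (chords allowed) such that every vertex off P is isolated
-- and the last vertex of P is a leaf.  Whatever edge {a,b} the opponent
-- claims, the invariant can be restored while P grows by one or two edges:
--   * a, b both on P: hang a fresh leaf on the first vertex of P;
--   * a an endpoint of P, b fresh: b extends P; hang a fresh leaf on b;
--   * a an inner vertex of P, b fresh: claim b–(first vertex of P), so that
--     {a,b} becomes a chord and the leaf at the far end survives;
--   * a, b both fresh: claim b–(first vertex of P), so that P becomes a–b–P.
-- Since the length grows in steps of one or two, it eventually equals ℓ or
-- ℓ + 1, and ℓ + 2 ≤ n guarantees a fresh vertex whenever one is needed.
module Submission where

open import Defs
open import Data.Nat using (ℕ; zero; suc; _+_; _≤_; _<_; _∸_; s≤s)
open import Data.Nat.Properties
  using (suc-injective; +-suc; +-comm; m≤m+n; m≤n+m; +-monoʳ-≤; m+[n∸m]≡n; <⇒≤; <⇒≱; ≤-trans; ≤-reflexive)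
open import Data.Fin using (Fin; zero; suc; inject₁; fromℕ; fromℕ<; opposite)
open import Data.Fin.Properties using (any?; all?; <-cmp; <⇒≢; injective⇒≤; opposite-involutive)
  renaming (_≟_ to _≟ᶠ_)
open import Data.Vec.Functional using (Vector; reverse) renaming (_∷_ to _◂_)
open import Data.List using (List; []; _∷_; length; filter; allFin)
open import Data.List.Properties using (filter-accept; filter-reject; filter-none; filter-≐)
open import Data.List.Membership.Propositional using (_∈_)
open import Data.List.Membership.Propositional.Properties using (∈-allFin)
open import Data.List.Relation.Unary.Any using (here; there)
import Data.List.Relation.Unary.All as All
open import Data.List.Relation.Unary.AllPairs using (_∷_)
open import Data.List.Relation.Unary.Unique.Propositional using (Unique)
open import Data.List.Relation.Unary.Unique.Propositional.Properties using (allFin⁺)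
open import Data.Product using (_×_; _,_; ∃; ∃₂; proj₁; proj₂)
open import Data.Sum using (_⊎_; inj₁; inj₂; [_,_])
open import Data.Empty using (⊥-elim)
open import Relation.Nullary using (¬_; yes; no; contradiction; ¬?)
open import Relation.Binary using (DecidableEquality; tri<; tri≈; tri>)
open import Relation.Binary.PropositionalEquality using (_≡_; _≢_; refl; sym; trans; cong; subst; ≢-sym)
open import Function using (_∘_)
open import Function.Definitions using (Injective)

private
  variable
    n k m : ℕ
    G : Graph n
    e : Fin n × Fin n
    s t u v w x y : Fin n

length-filter-≟-unique : ∀ {A : Set} (_≟_ : DecidableEquality A) {xs : List A} {x : A} →
                         Unique xs → x ∈ xs → length (filter (_≟ x) xs) ≡ 1
length-filter-≟-unique _≟_ {x = x} (x≢xs ∷ _) (here refl) =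
  cong length (trans (filter-accept (_≟ x) refl)
                     (cong (x ∷_) (filter-none (_≟ x) (All.map ≢-sym x≢xs))))
length-filter-≟-unique _≟_ (y≢xs ∷ xs!) (there x∈xs) =
  trans (cong length (filter-reject (_≟ _) (All.lookup y≢xs x∈xs)))
        (length-filter-≟-unique _≟_ xs! x∈xs)

∃-notInImage : (q : Fin k → Fin n) → k < n → ∃ λ v → ∀ i → q i ≢ v
∃-notInImage {k} {n} q k<n with any? (λ v → all? (λ i → ¬? (q i ≟ᶠ v)))
... | yes missed = missed
... | no ¬missed = contradiction (injective⇒≤ preimage-injective) (<⇒≱ k<n)
  where
  preimage : ∀ v → ∃ λ i → q i ≡ v
  preimage v with any? (λ i → q i ≟ᶠ v)
  ... | yes hit = hit
  ... | no ¬hit = ⊥-elim (¬missed (v , λ i qi≡v → ¬hit (i , qi≡v)))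

  preimage-injective : Injective _≡_ _≡_ (proj₁ ∘ preimage)
  preimage-injective {v} {v′} eq =
    trans (sym (proj₂ (preimage v))) (trans (cong q eq) (proj₂ (preimage v′)))

opposite-inject₁ : (i : Fin k) → opposite (inject₁ i) ≡ suc (opposite i)
opposite-inject₁ {suc k} zero    = refl
opposite-inject₁ {suc k} (suc i) = cong inject₁ (opposite-inject₁ i)

opposite-injective : Injective _≡_ _≡_ (opposite {k})
opposite-injective {_} {i} {j} eq =
  trans (sym (opposite-involutive i)) (trans (cong opposite eq) (opposite-involutive j))

-- Definitionally the predicate under Any in Adj, so that (here j) is an adjacency.
Joins : Fin n × Fin n → Fin n → Fin n → Set
Joins (a , b) u v = (a ≡ u × b ≡ v) ⊎ (a ≡ v × b ≡ u)

Joins-sym : Joins e u v → Joins e v u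
Joins-sym (inj₁ (a≡u , b≡v)) = inj₂ (a≡u , b≡v)
Joins-sym (inj₂ (a≡v , b≡u)) = inj₁ (a≡v , b≡u)

Joins-endpoint : Joins e s t → Joins e u v → u ≡ s ⊎ u ≡ t
Joins-endpoint (inj₁ (refl , refl)) (inj₁ (refl , _)) = inj₁ refl
Joins-endpoint (inj₁ (refl , refl)) (inj₂ (_ , refl)) = inj₂ refl
Joins-endpoint (inj₂ (refl , refl)) (inj₁ (refl , _)) = inj₂ refl
Joins-endpoint (inj₂ (refl , refl)) (inj₂ (_ , refl)) = inj₁ refl

Joins-other : Joins e s t → Joins e s u → u ≡ t
Joins-other (inj₁ (refl , refl)) (inj₁ (_ , refl)) = refl
Joins-other (inj₁ (refl , refl)) (inj₂ (refl , refl)) = refl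
Joins-other (inj₂ (refl , refl)) (inj₁ (refl , refl)) = refl
Joins-other (inj₂ (refl , refl)) (inj₂ (refl , _)) = refl

Adj-sym : Adj G u v → Adj G v u
Adj-sym (here j)  = here (Joins-sym j)
Adj-sym (there a) = there (Adj-sym a)

legalMove : u ≢ v → ¬ Adj G u v → ∃₂ λ c d → Legal G c d × Joins (c , d) u v
legalMove {u = u} {v} u≢v ¬adj with <-cmp u v
... | tri< u<v _ _ = u , v , (u<v , ¬adj) , inj₁ (refl , refl)
... | tri≈ _ u≡v _ = contradiction u≡v u≢v
... | tri> _ _ v<u = v , u , (v<u , ¬adj ∘ Adj-sym) , inj₂ (refl , refl)

Isolated : Graph n → Fin n → Set
Isolated G w = ∀ u → ¬ Adj G w u

Isolated-∷ : Isolated G w → Joins e s t → s ≢ w → t ≢ w → Isolated (e ∷ G) w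
Isolated-∷ iso j s≢w t≢w u (here j′) =
  [ s≢w ∘ sym , t≢w ∘ sym ] (Joins-endpoint j j′)
Isolated-∷ iso j s≢w t≢w u (there adj) = iso u adj

Leaf : Graph n → Fin n → Set
Leaf G x = ∃ λ c → Adj G x c × ∀ u → Adj G x u → u ≡ c

Leaf-∷ : Leaf G x → Joins e s t → s ≢ x → t ≢ x → Leaf (e ∷ G) x
Leaf-∷ (c , adj , unique) j s≢x t≢x = c , there adj , unique′
  where
  unique′ : ∀ u → Adj (_ ∷ _) _ u → u ≡ c
  unique′ u (here j′) =
    ⊥-elim ([ s≢x ∘ sym , t≢x ∘ sym ] (Joins-endpoint j j′))
  unique′ u (there adj′) = unique u adj′

deg-isolated : Isolated G w → deg G w ≡ 0
deg-isolated {n} {G} {w} iso =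
  cong length (filter-none (Adj? G w) (All.tabulate {xs = allFin n} λ {u} _ → iso u))

deg-leaf : Leaf G x → deg G x ≡ 1
deg-leaf {n} {G} {x} (c , adj , unique) =
  trans (cong length (filter-≐ (Adj? G x) (_≟ᶠ c) ((λ {u} → unique u) , λ { refl → adj }) (allFin n)))
        (length-filter-≟-unique _≟ᶠ_ (allFin⁺ n) (∈-allFin c))

OnPath : Vector (Fin n) k → Fin n → Set
OnPath p x = ∃ λ i → p i ≡ x

OffPath : Vector (Fin n) k → Fin n → Set
OffPath p x = ∀ i → p i ≢ x

OffPathIsolated : Graph n → Vector (Fin n) k → Set
OffPathIsolated G p = ∀ w → OffPath p w → Isolated G w

CoveringPath : Graph n → (k : ℕ) → Vector (Fin n) (suc k) → Set
CoveringPath G k p = IsPath G k p × OffPathIsolated G p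

◂-injective : {p : Vector (Fin n) k} → Injective _≡_ _≡_ p → OffPath p y → Injective _≡_ _≡_ (y ◂ p)
◂-injective inj off {zero}  {zero}  eq = refl
◂-injective inj off {zero}  {suc j} eq = contradiction (sym eq) (off j)
◂-injective inj off {suc i} {zero}  eq = contradiction eq (off i)
◂-injective inj off {suc i} {suc j} eq = cong suc (inj eq)

IsPath-weaken : {p : Vector (Fin n) (suc k)} → IsPath G k p → IsPath (e ∷ G) k p
IsPath-weaken (inj , adj) = inj , there ∘ adj

IsPath-◂ : {p : Vector (Fin n) (suc k)} → IsPath G k p → OffPath p y → Adj G y (p zero) →
           IsPath G (suc k) (y ◂ p)
IsPath-◂ (inj , adj) off y∼p₀ = ◂-injective inj off , λ { zero → y∼p₀ ; (suc i) → adj i }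

IsPath-reverse : {p : Vector (Fin n) (suc k)} → IsPath G k p → IsPath G k (reverse p)
IsPath-reverse {G = G} {p = p} (inj , adj) = opposite-injective ∘ inj , adj′
  where
  adj′ : ∀ i → Adj G (p (opposite (inject₁ i))) (p (inject₁ (opposite i)))
  adj′ i rewrite opposite-inject₁ i = Adj-sym (adj (opposite i))

OffPathIsolated-◂ : {p : Vector (Fin n) k} → OffPathIsolated G p → OffPathIsolated G (y ◂ p)
OffPathIsolated-◂ iso w off = iso w (off ∘ suc)

OffPathIsolated-reverse : {p : Vector (Fin n) (suc k)} → OffPathIsolated G p → OffPathIsolated G (reverse p)
OffPathIsolated-reverse {p = p} iso w off =
  iso w λ i p≡w → off (opposite i) (trans (cong p (opposite-involutive i)) p≡w)

OffPathIsolated-∷ : {p : Vector (Fin n) k} → OffPathIsolated G p → Joins e s t →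
                    OnPath p s → OnPath p t → OffPathIsolated (e ∷ G) p
OffPathIsolated-∷ iso j (i , pi≡s) (i′ , pi′≡t) w off =
  Isolated-∷ (iso w off) j (off i ∘ trans pi≡s) (off i′ ∘ trans pi′≡t)

CoveringPath-singleton : (v : Fin n) → CoveringPath [] 0 (λ _ → v)
CoveringPath-singleton v = ((λ { {zero} {zero} _ → refl }) , λ ()) , λ _ _ _ ()

CoveringPath-reverse : {p : Vector (Fin n) (suc k)} → CoveringPath G k p → CoveringPath G k (reverse p)
CoveringPath-reverse (path , iso) = IsPath-reverse path , OffPathIsolated-reverse iso

CoveringPath-chord : {p : Vector (Fin n) (suc k)} → CoveringPath G k p → Joins e s t →
                     OnPath p s → OnPath p t → CoveringPath (e ∷ G) k p
CoveringPath-chord (path , iso) j on-s on-t = IsPath-weaken path , OffPathIsolated-∷ iso j on-s on-t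

CoveringPath-◂ : {p : Vector (Fin n) (suc k)} → CoveringPath G k p → OffPath p y → Joins e y (p zero) →
                 CoveringPath (e ∷ G) (suc k) (y ◂ p)
CoveringPath-◂ (path , iso) off j =
  IsPath-◂ (IsPath-weaken path) off (here j) ,
  OffPathIsolated-∷ (OffPathIsolated-◂ iso) j (zero , refl) (suc zero , refl)

record LeafEndedPath (G : Graph n) (m : ℕ) : Set where
  field
    path     : Vector (Fin n) (suc (suc m))
    covering : CoveringPath G (suc m) path
    leaf     : Leaf G (path (fromℕ (suc m)))

open LeafEndedPath

LeafEndedPath⇒Goal : ∀ {ℓ} → LeafEndedPath G m → (suc m ≡ ℓ ⊎ suc m ≡ suc ℓ) → Goal ℓ G
LeafEndedPath⇒Goal P length≡ =
  suc _ , length≡ , path P , proj₁ (covering P) ,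
  (λ w off → deg-isolated (proj₂ (covering P) w off)) , inj₂ (deg-leaf (leaf P))

Move : Graph n → ℕ → Set
Move G m = ∃₂ λ c d → Legal G c d × LeafEndedPath ((c , d) ∷ G) m

extendByLeaf : {p : Vector (Fin n) (suc k)} → CoveringPath G k p → suc k < n → Move G k
extendByLeaf {p = p} cover@(_ , iso) room with ∃-notInImage p room
... | w , off with legalMove (≢-sym (off zero)) (iso w off (p zero))
... | c , d , legal , w–p₀ = c , d , legal , record
  { path     = reverse (w ◂ p)
  ; covering = CoveringPath-reverse (CoveringPath-◂ cover off w–p₀)
  ; leaf     = subst (Leaf _ ∘ (w ◂ p)) (sym (opposite-involutive zero)) w-leaf
  }
  where
  w-leaf : Leaf ((c , d) ∷ _) w
  w-leaf = p zero , here w–p₀ , λ where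
    u (here j)    → Joins-other w–p₀ j
    u (there adj) → contradiction adj (iso w off u)

Reply : Graph n → ℕ → Set
Reply G m = Move G (suc m) ⊎ Move G (suc (suc m))

module _ {G : Graph n} {m : ℕ} (P : LeafEndedPath G m) where
  private
    q = path P
    last = fromℕ (suc m)

    q-injective : Injective _≡_ _≡_ q
    q-injective = proj₁ (proj₁ (covering P))

    q-iso : OffPathIsolated G q
    q-iso = proj₂ (covering P)

    q₀≢qlast : q zero ≢ q last
    q₀≢qlast = (λ ()) ∘ q-injective

  replyInner : (i : Fin (suc (suc m))) → Joins e y (q i) → i ≢ zero → i ≢ last → OffPath q y →
               Move (e ∷ G) (suc m)
  replyInner {e} {y} i y–qᵢ i≢0 i≢last off with legalMove (≢-sym (off zero)) ¬y∼q₀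
    where
    ¬y∼q₀ : ¬ Adj (e ∷ G) y (q zero)
    ¬y∼q₀ (here y–q₀) = i≢0 (sym (q-injective (Joins-other y–qᵢ y–q₀)))
    ¬y∼q₀ (there adj) = q-iso y off (q zero) adj
  ... | c , d , legal , y–q₀ = c , d , legal , record
    { path     = y ◂ q
    ; covering = IsPath-◂ (IsPath-weaken (IsPath-weaken (proj₁ (covering P)))) off (here y–q₀) ,
                 OffPathIsolated-∷ (OffPathIsolated-∷ (OffPathIsolated-◂ q-iso) y–qᵢ (zero , refl) (suc i , refl))
                                   y–q₀ (zero , refl) (suc zero , refl)
    ; leaf     = Leaf-∷ (Leaf-∷ (leaf P) y–qᵢ y≢qlast (i≢last ∘ q-injective)) y–q₀ y≢qlast q₀≢qlast
    }
    where
    y≢qlast : y ≢ q last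
    y≢qlast = off last ∘ sym

  replyOutside : Joins e s t → s ≢ t → OffPath q s → OffPath q t → Move (e ∷ G) (suc (suc m))
  replyOutside {e} {s} {t} s–t s≢t s-off t-off with legalMove (≢-sym (t-off zero)) ¬t∼q₀
    where
    ¬t∼q₀ : ¬ Adj (e ∷ G) t (q zero)
    ¬t∼q₀ (here t–q₀) = s-off zero (Joins-other (Joins-sym s–t) t–q₀)
    ¬t∼q₀ (there adj) = q-iso t t-off (q zero) adj
  ... | c , d , legal , t–q₀ = c , d , legal , record
    { path     = s ◂ t ◂ q
    ; covering = IsPath-◂ (IsPath-◂ (IsPath-weaken (IsPath-weaken (proj₁ (covering P)))) t-off (here t–q₀))
                          s-off′ (there (here s–t)) ,
                 OffPathIsolated-∷ (OffPathIsolated-∷ (OffPathIsolated-◂ (OffPathIsolated-◂ q-iso))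
                                                      s–t (zero , refl) (suc zero , refl))
                                   t–q₀ (suc zero , refl) (suc (suc zero) , refl)
    ; leaf     = Leaf-∷ (Leaf-∷ (leaf P) s–t (s-off last ∘ sym) t≢qlast) t–q₀ t≢qlast q₀≢qlast
    }
    where
    s-off′ : OffPath (t ◂ q) s
    s-off′ zero    = s≢t ∘ sym
    s-off′ (suc i) = s-off i

    t≢qlast : t ≢ q last
    t≢qlast = t-off last ∘ sym

  replyAtVertex : 3 + m < n → (i : Fin (suc (suc m))) → Joins e y (q i) → OffPath q y → Reply (e ∷ G) m
  replyAtVertex room i y–qᵢ off with i ≟ᶠ zero | i ≟ᶠ last
  ... | yes refl | _        = inj₂ (extendByLeaf (CoveringPath-◂ (covering P) off y–qᵢ) room)
  ... | no _     | yes refl =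
    -- the last vertex of q is the first vertex of reverse q
    inj₂ (extendByLeaf (CoveringPath-◂ (CoveringPath-reverse (covering P)) (off ∘ opposite) y–qᵢ) room)
  ... | no i≢0   | no i≢last = inj₁ (replyInner i y–qᵢ i≢0 i≢last off)

  reply : 3 + m < n → ∀ {a b} → Legal G a b → Reply ((a , b) ∷ G) m
  reply room (a<b , _) with any? (λ i → q i ≟ᶠ _) | any? (λ i → q i ≟ᶠ _)
  ... | yes on-a        | yes on-b        =
    inj₁ (extendByLeaf (CoveringPath-chord (covering P) (inj₁ (refl , refl)) on-a on-b) (<⇒≤ room))
  ... | yes (i , refl)  | no ¬on-b        = replyAtVertex room i (inj₂ (refl , refl)) (λ j → ¬on-b ∘ (j ,_))
  ... | no ¬on-a        | yes (i , refl)  = replyAtVertex room i (inj₁ (refl , refl)) (λ j → ¬on-a ∘ (j ,_))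
  ... | no ¬on-a        | no ¬on-b        =
    inj₂ (replyOutside (inj₁ (refl , refl)) (<⇒≢ a<b) (λ j → ¬on-a ∘ (j ,_)) (λ j → ¬on-b ∘ (j ,_)))

module Strategy (ℓ : ℕ) (room : 2 + ℓ ≤ n) where

  respond : ∀ r {G : Graph n} {m} → Move G m → r + suc m ≡ suc ℓ → Force ℓ G
  respond zero          (c , d , legal , P) length≡ = win c d legal (LeafEndedPath⇒Goal P (inj₂ length≡))
  respond (suc zero)    (c , d , legal , P) length≡ =
    win c d legal (LeafEndedPath⇒Goal P (inj₁ (suc-injective length≡)))
  respond (suc (suc r)) {m = m} (c , d , legal , P) length≡ =
    play c d legal opponentMove λ _ _ legal′ →
      [ (λ move → respond (suc r) move length₁≡) , (λ move → respond r move length₂≡) ] (reply P room′ legal′)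
    where
    room′ : 3 + m < n
    room′ = ≤-trans (s≤s (subst (3 + m ≤_) length≡ (s≤s (s≤s (m≤n+m (suc m) r))))) room

    opponentMove : ∃₂ λ a b → Legal ((c , d) ∷ _) a b
    opponentMove with extendByLeaf (covering P) (<⇒≤ room′)
    ... | a , b , legal′ , _ = a , b , legal′

    length₁≡ : suc r + suc (suc m) ≡ suc ℓ
    length₁≡ = trans (cong suc (+-suc r (suc m))) length≡

    length₂≡ : r + suc (suc (suc m)) ≡ suc ℓ
    length₂≡ = trans (+-suc r (suc (suc m))) length₁≡

  firstPlayer : Force ℓ []
  firstPlayer = respond ℓ (extendByLeaf (CoveringPath-singleton (fromℕ< (<⇒≤ 1<n))) 1<n) (+-comm ℓ 1)
    where
    1<n : 1 < n
    1<n = ≤-trans (m≤m+n 2 ℓ) room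

  secondPlayer : 1 ≤ ℓ → ∀ i j → Legal [] i j → Force ℓ ((i , j) ∷ [])
  secondPlayer 1≤ℓ i j (i<j , _) =
    respond (ℓ ∸ 1) (extendByLeaf path-ij (≤-trans (s≤s (s≤s 1≤ℓ)) room))
            (trans (+-suc (ℓ ∸ 1) 1) (cong suc (trans (+-comm (ℓ ∸ 1) 1) (m+[n∸m]≡n 1≤ℓ))))
    where
    path-ij : CoveringPath ((i , j) ∷ []) 1 (i ◂ λ _ → j)
    path-ij = CoveringPath-◂ (CoveringPath-singleton j) (λ _ → <⇒≢ i<j ∘ sym) (inj₁ (refl , refl))

lemma1p10 : (n ℓ : ℕ) → 3 ≤ n → 1 ≤ ℓ → ℓ ≤ n ∸ 2 →
    Force {n} ℓ [] ×
    (∀ i j → Legal {n} [] i j → Force ℓ ((i , j) ∷ []))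
lemma1p10 n ℓ 3≤n 1≤ℓ ℓ≤n∸2 = firstPlayer , secondPlayer 1≤ℓ
  where
  open Strategy ℓ (≤-trans (+-monoʳ-≤ 2 ℓ≤n∸2) (≤-reflexive (m+[n∸m]≡n (<⇒≤ 3≤n))))
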